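{- Let $k$ be even and let $K$ be the complete graph on $k$ vertices, each of whose edges $e$ is assigned a round $r(e)\in\{1,2,3\}$. For a perfect matching $M$ of $K$ and $i\in\{1,2,3\}$, let $M_i=\{e\in M: r(e)=i\}$, $m_i=|M_i|$, and let $V_{M_i}$ be the set of vertices covered by $M_i$. Let $M$ be a perfect matching of $K$ that maximizes $m_1+m_2$ and, among those, maximizes $m_1$. Call an edge $e$ of $K$ free if it has an endpoint lying in $V_{M_j}$ for some $j>r(e)$. Then the number of free edges is at most $\frac{1}{2}\binom{k}{2}$.
   Context: This models a clique $K$ of size $k$ found by a three-round query algorithm, where $r(e)$ is the round in which the pair $e$ was queried. -}

module Defs where

import Level
open import Data.Nat using (ℕ; suc; _+_; _*_; _≤_; _<_)
open import Data.Fin using (Fin; toℕ)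
open import Data.Fin.Properties using (_≟_)
open import Data.List using (List; length; filter; cartesianProduct; allFin)
open import Data.Product using (_×_; _,_; proj₁; proj₂)
open import Data.Sum using (_⊎_)
open import Relation.Binary.PropositionalEquality using (_≡_; _≢_)
open import Relation.Unary using (Pred; Decidable)
import Data.Fin as F
import Data.Nat as N
open import Relation.Nullary.Decidable using (_⊎-dec_; _×-dec_)

-- Rounds 1,2,3 are represented by Fin 3 (0 ↦ round 1, 1 ↦ round 2, 2 ↦ round 3),
-- with the usual order on Fin 3.
Round : Set
Round = Fin 3

round1 round2 : Round
round1 = F.zero
round2 = F.suc F.zero

-- Vertices of K are Fin k.  An edge {u,v} of K is listed once, as (u , v) with u < v.
Edge : ℕ → Set
Edge k = Fin k × Fin k

edges : (k : ℕ) → List (Edge k)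
edges k = filter (λ e → toℕ (proj₁ e) N.<? toℕ (proj₂ e))
                 (cartesianProduct (allFin k) (allFin k))

countEdges : (k : ℕ) {P : Pred (Edge k) Level.zero} → Decidable P → ℕ
countEdges k P? = length (filter P? (edges k))

-- A round assignment: a function on ordered pairs that is symmetric,
-- so that r u v is the round of the (unordered) edge {u,v}.
record RoundAssignment (k : ℕ) : Set where
  field
    r    : Fin k → Fin k → Round
    symm : ∀ u v → r u v ≡ r v u
open RoundAssignment public

-- A perfect matching of K, given by its partner map: a fixed-point-free
-- involution; the matching is M = { {v , partner v} : v ∈ Fin k }.
record PerfectMatching (k : ℕ) : Set where
  field
    partner    : Fin k → Fin k
    involutive : ∀ v → partner (partner v) ≡ v
    noFixed    : ∀ v → partner v ≢ v
open PerfectMatching public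

module _ {k : ℕ} (R : RoundAssignment k) (M : PerfectMatching k) where

  InM : Edge k → Set
  InM (u , v) = partner M u ≡ v

  inM? : Decidable InM
  inM? (u , v) = partner M u ≟ v

  InMi : Round → Edge k → Set
  InMi i (u , v) = InM (u , v) × (r R u v ≡ i)

  inMi? : (i : Round) → Decidable (InMi i)
  inMi? i (u , v) = inM? (u , v) ×-dec (r R u v ≟ i)

  m : Round → ℕ
  m i = countEdges k (inMi? i)

  -- v ∈ V_{M_j}  iff  the M-edge covering v has round j
  roundAt : Fin k → Round
  roundAt v = r R v (partner M v)

  Free : Edge k → Set
  Free (u , v) = (r R u v F.< roundAt u) ⊎ (r R u v F.< roundAt v)

  free? : Decidable Free
  free? (u , v) = (r R u v F.<? roundAt u) ⊎-dec (r R u v F.<? roundAt v)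

  numFree : ℕ
  numFree = countEdges k free?

Optimal : {k : ℕ} → RoundAssignment k → PerfectMatching k → Set
Optimal R M = ∀ M' →
  (m R M' round1 + m R M' round2 < m R M round1 + m R M round2)
  ⊎ ((m R M' round1 + m R M' round2 ≡ m R M round1 + m R M round2)
     × (m R M' round1 ≤ m R M round1))

-- Write p for the partner map of M and ρ a for the round of the M-edge at a.
-- For distinct u, v with v ≠ p u, exchanging the M-edges {u, p u}, {v, p v} for
-- {u, v}, {p u, p v} gives another perfect matching.  If {u, v} and {p u, p v} were
-- both free, both new edges would have rounds below max (ρ u) (ρ v); the exchange
-- would then increase (m₁ + m₂ , m₁) lexicographically, contradicting the choice of M.
-- So the involution {u, v} ↦ {p u, p v} on the edges of K never maps a free edge to a
-- free edge, and an involution with this property leaves at most half the edges free.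

module Submission where

open import Data.Bool.Base using (if_then_else_)
open import Data.Fin.Base using (Fin; zero; suc) renaming (_<_ to _<ᶠ_)
open import Data.Fin.Permutation using (Permutation; permutation; _⟨$⟩ʳ_; _⟨$⟩ˡ_; inverseˡ; inverseʳ; transpose)
import Data.Fin.Permutation.Components as PC
open import Data.Fin.Properties using (_≟_; _<?_; <-cmp; <-irrefl; all?)
open import Data.List.Base using (List; []; _∷_; map; _++_; filter; length; cartesianProduct; tabulate; allFin)
open import Data.List.Membership.Propositional using (_∈_; _∉_)
import Data.List.Membership.DecPropositional as DecMembership
open import Data.List.Properties using (map-++; map-∘)
open import Data.List.Relation.Unary.All using ([]; _∷_)
open import Data.List.Relation.Unary.All.Properties using (All¬⇒¬Any)
open import Data.List.Relation.Unary.Any using (here; there)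
open import Data.List.Relation.Unary.Unique.Propositional using (Unique; []; _∷_)
open import Data.Nat.Base using (ℕ; _+_; _*_; _<_; _≤_; z≤n)
open import Data.Nat.Combinatorics using (_C_; nC1≡n; nCk+nC[k+1]≡[n+1]C[k+1])
open import Data.Nat.Divisibility using (_∣_)
open import Data.Nat.ListAction using () renaming (sum to sumᴸ)
open import Data.Nat.ListAction.Properties using (sum-++)
open import Data.Nat.Properties
  using ( +-0-commutativeMonoid; +-commutativeSemigroup; *-commutativeSemigroup
        ; +-comm; +-identityʳ; *-identityˡ; *-distribʳ-+; *-cancelˡ-≡; *-cancelˡ-≤
        ; ≤-refl; ≤-trans; ≤-reflexive; +-mono-≤; +-mono-<; +-mono-<-≤; +-mono-≤-<
        ; module ≤-Reasoning)
import Data.Nat.Properties as ℕₚ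
open import Algebra.Properties.CommutativeSemigroup +-commutativeSemigroup using (interchange)
open import Algebra.Properties.CommutativeSemigroup *-commutativeSemigroup using (x∙yz≈y∙xz)
open import Data.Nat.Tactic.RingSolver using (solve-∀)
open import Data.Product.Base using (_×_; _,_)
open import Data.Product.Relation.Binary.Lex.Strict using (×-Lex; ×-decidable)
open import Data.Sum.Base using (_⊎_; inj₁; inj₂; [_,_]′)
import Data.Sum.Base as Sum
open import Function.Base using (_∘_; id)
open import Level using (0ℓ)
open import Relation.Binary.Core using (Rel)
open import Relation.Binary.Definitions using (tri<; tri≈; tri>)
open import Relation.Binary.PropositionalEquality
  using (_≡_; _≢_; refl; sym; trans; cong; cong₂; subst; module ≡-Reasoning)
open import Relation.Nullary.Decidable
  using (Dec; yes; no; does; dec-true; dec-false; _×-dec_; _⊎-dec_; _→-dec_; toWitness)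
open import Relation.Nullary.Negation using (¬_; contradiction)
open import Relation.Unary using (Pred; Decidable)
open import Algebra.Properties.CommutativeMonoid.Sum +-0-commutativeMonoid
  using (sum; sum-syntax; sum-cong-≗; ∑-distrib-+; ∑-comm; sum-permute; sum-replicate-zero)

open import Defs

𝟙 : ∀ {p} {P : Set p} → Dec P → ℕ
𝟙 d = if does d then 1 else 0

𝟙-yes : ∀ {p} {P : Set p} → P → (d : Dec P) → 𝟙 d ≡ 1
𝟙-yes _ (yes _) = refl
𝟙-yes p (no ¬p) = contradiction p ¬p

𝟙-no : ∀ {p} {P : Set p} → ¬ P → (d : Dec P) → 𝟙 d ≡ 0
𝟙-no ¬p (yes p) = contradiction p ¬p
𝟙-no _  (no _)  = refl

𝟙-⇔ : ∀ {p q} {P : Set p} {Q : Set q} → (P → Q) → (Q → P) → (d : Dec P) (e : Dec Q) → 𝟙 d ≡ 𝟙 e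
𝟙-⇔ P→Q Q→P (yes p) e = sym (𝟙-yes (P→Q p) e)
𝟙-⇔ P→Q Q→P (no ¬p) e = sym (𝟙-no (¬p ∘ Q→P) e)

𝟙+𝟙≤1 : ∀ {p q} {P : Set p} {Q : Set q} → (P → ¬ Q) → (d : Dec P) (e : Dec Q) → 𝟙 d + 𝟙 e ≤ 1
𝟙+𝟙≤1 P→¬Q (yes p) (yes q) = contradiction q (P→¬Q p)
𝟙+𝟙≤1 P→¬Q (yes _) (no _)  = ≤-refl
𝟙+𝟙≤1 P→¬Q (no _)  e       = 𝟙≤1 e
  where
  𝟙≤1 : ∀ {q} {Q : Set q} (e : Dec Q) → 𝟙 e ≤ 1
  𝟙≤1 (yes _) = ≤-refl
  𝟙≤1 (no _)  = z≤n

𝟙-×-dec : ∀ {p q} {P : Set p} {Q : Set q} (d : Dec P) (e : Dec Q) → 𝟙 (d ×-dec e) ≡ 𝟙 d * 𝟙 e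
𝟙-×-dec (yes _) e = sym (+-identityʳ (𝟙 e))
𝟙-×-dec (no _)  e = refl

module _ {n : ℕ} where

  𝟙<-irrefl : (u : Fin n) → 𝟙 (u <? u) ≡ 0
  𝟙<-irrefl u = 𝟙-no (<-irrefl refl) (u <? u)

  𝟙<+𝟙>≡1 : {u v : Fin n} → u ≢ v → 𝟙 (u <? v) + 𝟙 (v <? u) ≡ 1
  𝟙<+𝟙>≡1 {u} {v} u≢v with <-cmp u v
  ... | tri< u<v _ v≮u = cong₂ _+_ (𝟙-yes u<v (u <? v)) (𝟙-no v≮u (v <? u))
  ... | tri≈ _ u≡v _   = contradiction u≡v u≢v
  ... | tri> u≮v _ v<u = cong₂ _+_ (𝟙-no u≮v (u <? v)) (𝟙-yes v<u (v <? u))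

∑-mono-≤ : ∀ {n} {f g : Fin n → ℕ} → (∀ i → f i ≤ g i) → sum f ≤ sum g
∑-mono-≤ {ℕ.zero}  f≤g = z≤n
∑-mono-≤ {ℕ.suc n} f≤g = +-mono-≤ (f≤g zero) (∑-mono-≤ (f≤g ∘ suc))

∑-δ : ∀ {n} (w : Fin n) (f : Fin n → ℕ) → ∑[ a < n ] (𝟙 (a ≟ w) * f a) ≡ f w
∑-δ {ℕ.suc n} zero    f = trans (cong₂ _+_ (+-identityʳ (f zero)) (sum-replicate-zero n))
                                (+-identityʳ (f zero))
∑-δ {ℕ.suc n} (suc w) f = ∑-δ w (f ∘ suc)

module _ {n : ℕ} where
  open DecMembership (_≟_ {n}) using (_∈?_)

  𝟙-∈-∷ : ∀ {w ws} a → w ∉ ws → 𝟙 (a ∈? w ∷ ws) ≡ 𝟙 (a ≟ w) + 𝟙 (a ∈? ws)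
  𝟙-∈-∷ {w} {ws} a w∉ws with a ≟ w
  ... | yes refl = cong (1 +_) (sym (𝟙-no w∉ws (a ∈? ws)))
  ... | no _     = refl

  ∑-restrict : ∀ {ws} → Unique ws → (f : Fin n → ℕ) →
               ∑[ a < n ] (𝟙 (a ∈? ws) * f a) ≡ sumᴸ (map f ws)
  ∑-restrict [] f = sum-replicate-zero n
  ∑-restrict {w ∷ ws} (w∉ws ∷ ws!) f = begin
    ∑[ a < n ] (𝟙 (a ∈? w ∷ ws) * f a)
      ≡⟨ sum-cong-≗ (λ a → cong (_* f a) (𝟙-∈-∷ a (All¬⇒¬Any w∉ws))) ⟩
    ∑[ a < n ] ((𝟙 (a ≟ w) + 𝟙 (a ∈? ws)) * f a)
      ≡⟨ sum-cong-≗ (λ a → *-distribʳ-+ (f a) (𝟙 (a ≟ w)) _) ⟩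
    ∑[ a < n ] (𝟙 (a ≟ w) * f a + 𝟙 (a ∈? ws) * f a)
      ≡⟨ ∑-distrib-+ (λ a → 𝟙 (a ≟ w) * f a) (λ a → 𝟙 (a ∈? ws) * f a) ⟩
    ∑[ a < n ] (𝟙 (a ≟ w) * f a) + ∑[ a < n ] (𝟙 (a ∈? ws) * f a)
      ≡⟨ cong₂ _+_ (∑-δ w f) (∑-restrict ws! f) ⟩
    f w + sumᴸ (map f ws) ∎
    where open ≡-Reasoning

  ∑-agree-outside : ∀ {ws} → Unique ws → {f g : Fin n → ℕ} → (∀ a → a ∉ ws → f a ≡ g a) →
                    sum f + sumᴸ (map g ws) ≡ sum g + sumᴸ (map f ws)
  ∑-agree-outside {ws} ws! {f} {g} f≡g = begin
    sum f + sumᴸ (map g ws)                     ≡⟨ cong (sum f +_) (∑-restrict ws! g) ⟨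
    sum f + ∑[ a < n ] (𝟙 (a ∈? ws) * g a)      ≡⟨ ∑-distrib-+ f (λ a → 𝟙 (a ∈? ws) * g a) ⟨
    ∑[ a < n ] (f a + 𝟙 (a ∈? ws) * g a)        ≡⟨ sum-cong-≗ (λ a → swap a (a ∈? ws)) ⟩
    ∑[ a < n ] (g a + 𝟙 (a ∈? ws) * f a)        ≡⟨ ∑-distrib-+ g (λ a → 𝟙 (a ∈? ws) * f a) ⟩
    sum g + ∑[ a < n ] (𝟙 (a ∈? ws) * f a)      ≡⟨ cong (sum g +_) (∑-restrict ws! f) ⟩
    sum g + sumᴸ (map f ws)                     ∎
    where
    open ≡-Reasoning
    swap : ∀ a (a∈? : Dec (a ∈ ws)) → f a + 𝟙 a∈? * g a ≡ g a + 𝟙 a∈? * f a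
    swap a (yes _)   = trans (cong (f a +_) (*-identityˡ (g a)))
                      (trans (+-comm (f a) (g a)) (cong (g a +_) (sym (*-identityˡ (f a)))))
    swap a (no a∉ws) = cong (_+ 0) (f≡g a a∉ws)

∑-involution : ∀ {n} {p : Fin n → Fin n} → (∀ a → p (p a) ≡ a) →
               (f : Fin n → ℕ) → sum f ≡ sum (f ∘ p)
∑-involution {p = p} p-inv f = sum-permute f (permutation p p p-inv p-inv)

involution-injective : ∀ {A : Set} {p : A → A} → (∀ a → p (p a) ≡ a) → ∀ {a b} → p a ≡ p b → a ≡ b
involution-injective {p = p} p-inv {a} {b} pa≡pb = trans (sym (p-inv a)) (trans (cong p pa≡pb) (p-inv b))

-- Counting edges of the complete graph

module _ {A : Set} where

  length-filter≡sum-𝟙 : {P : Pred A 0ℓ} (P? : Decidable P) (xs : List A) →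
                        length (filter P? xs) ≡ sumᴸ (map (𝟙 ∘ P?) xs)
  length-filter≡sum-𝟙 P? []       = refl
  length-filter≡sum-𝟙 P? (x ∷ xs) with P? x
  ... | yes _ = cong (1 +_) (length-filter≡sum-𝟙 P? xs)
  ... | no  _ = length-filter≡sum-𝟙 P? xs

  sum-map-filter : {P : Pred A 0ℓ} (P? : Decidable P) (f : A → ℕ) (xs : List A) →
                   sumᴸ (map f (filter P? xs)) ≡ sumᴸ (map (λ x → 𝟙 (P? x) * f x) xs)
  sum-map-filter P? f []       = refl
  sum-map-filter P? f (x ∷ xs) with P? x
  ... | yes _ = cong₂ _+_ (sym (+-identityʳ (f x))) (sum-map-filter P? f xs)
  ... | no  _ = sum-map-filter P? f xs

sum-map-cartesianProduct : ∀ {A B : Set} (f : A × B → ℕ) (xs : List A) (ys : List B) →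
  sumᴸ (map f (cartesianProduct xs ys)) ≡ sumᴸ (map (λ x → sumᴸ (map (λ y → f (x , y)) ys)) xs)
sum-map-cartesianProduct f []       ys = refl
sum-map-cartesianProduct f (x ∷ xs) ys = begin
  sumᴸ (map f (map (x ,_) ys ++ cartesianProduct xs ys))
    ≡⟨ cong sumᴸ (map-++ f (map (x ,_) ys) (cartesianProduct xs ys)) ⟩
  sumᴸ (map f (map (x ,_) ys) ++ map f (cartesianProduct xs ys))
    ≡⟨ sum-++ (map f (map (x ,_) ys)) (map f (cartesianProduct xs ys)) ⟩
  sumᴸ (map f (map (x ,_) ys)) + sumᴸ (map f (cartesianProduct xs ys))
    ≡⟨ cong₂ _+_ (cong sumᴸ (sym (map-∘ ys))) (sum-map-cartesianProduct f xs ys) ⟩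
  sumᴸ (map (λ y → f (x , y)) ys) + sumᴸ (map (λ x → sumᴸ (map (λ y → f (x , y)) ys)) xs) ∎
  where open ≡-Reasoning

sum-map-tabulate : ∀ {A : Set} {n} (f : A → ℕ) (g : Fin n → A) → sumᴸ (map f (tabulate g)) ≡ sum (f ∘ g)
sum-map-tabulate {n = ℕ.zero}  f g = refl
sum-map-tabulate {n = ℕ.suc n} f g = cong (f (g zero) +_) (sum-map-tabulate f (g ∘ suc))

∑² : ∀ {n} → (Fin n → Fin n → ℕ) → ℕ
∑² {n} f = ∑[ u < n ] ∑[ v < n ] f u v

countEdges≡∑² : ∀ k {P : Pred (Edge k) 0ℓ} (P? : Decidable P) →
                countEdges k P? ≡ ∑² (λ u v → 𝟙 (u <? v) * 𝟙 (P? (u , v)))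
countEdges≡∑² k P? = begin
  length (filter P? (filter ordered? pairs))
    ≡⟨ length-filter≡sum-𝟙 P? (filter ordered? pairs) ⟩
  sumᴸ (map (𝟙 ∘ P?) (filter ordered? pairs))
    ≡⟨ sum-map-filter ordered? (𝟙 ∘ P?) pairs ⟩
  sumᴸ (map summand pairs)
    ≡⟨ sum-map-cartesianProduct summand (allFin k) (allFin k) ⟩
  sumᴸ (map (λ u → sumᴸ (map (λ v → summand (u , v)) (allFin k))) (allFin k))
    ≡⟨ sum-map-tabulate (λ u → sumᴸ (map (λ v → summand (u , v)) (allFin k))) id ⟩
  ∑[ u < k ] sumᴸ (map (λ v → summand (u , v)) (allFin k))
    ≡⟨ sum-cong-≗ (λ u → sum-map-tabulate (λ v → summand (u , v)) id) ⟩
  ∑² (λ u v → 𝟙 (u <? v) * 𝟙 (P? (u , v))) ∎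
  where
  open ≡-Reasoning
  pairs : List (Edge k)
  pairs = cartesianProduct (allFin k) (allFin k)
  -- Fin's _<?_ unfolds to the comparison of toℕ used in edges k.
  ordered? : Decidable {A = Edge k} (λ (u , v) → u <ᶠ v)
  ordered? (u , v) = u <? v
  summand : Edge k → ℕ
  summand e = 𝟙 (ordered? e) * 𝟙 (P? e)

module _ {n : ℕ} where

  ∑²-symmetrize : (g : Fin n → Fin n → ℕ) → ∑² (λ u v → g u v + g v u) ≡ 2 * ∑² g
  ∑²-symmetrize g = begin
    ∑² (λ u v → g u v + g v u)
      ≡⟨ sum-cong-≗ (λ u → ∑-distrib-+ (g u) (λ v → g v u)) ⟩
    ∑[ u < n ] (∑[ v < n ] g u v + ∑[ v < n ] g v u)
      ≡⟨ ∑-distrib-+ (λ u → ∑[ v < n ] g u v) (λ u → ∑[ v < n ] g v u) ⟩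
    ∑² g + ∑² (λ u v → g v u)
      ≡⟨ cong (∑² g +_) (∑-comm g) ⟨
    ∑² g + ∑² g
      ≡⟨ cong (∑² g +_) (+-identityʳ (∑² g)) ⟨
    2 * ∑² g ∎
    where open ≡-Reasoning

  ∑²-involution-bound : {p : Fin n → Fin n} → (∀ a → p (p a) ≡ a) → (h b : Fin n → Fin n → ℕ) →
                        (∀ u v → h u v + h (p u) (p v) ≤ b u v) → 2 * ∑² h ≤ ∑² b
  ∑²-involution-bound {p} p-inv h b bound = begin
    2 * ∑² h                                 ≡⟨ cong (∑² h +_) (+-identityʳ (∑² h)) ⟩
    ∑² h + ∑² h                              ≡⟨ cong (∑² h +_) reindex ⟩
    ∑² h + ∑² (λ u v → h (p u) (p v))        ≡⟨ ∑²-distrib-+ ⟨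
    ∑² (λ u v → h u v + h (p u) (p v))       ≤⟨ ∑-mono-≤ (λ u → ∑-mono-≤ (bound u)) ⟩
    ∑² b                                     ∎
    where
    open ≤-Reasoning
    reindex : ∑² h ≡ ∑² (λ u v → h (p u) (p v))
    reindex = trans (∑-involution p-inv (λ u → ∑[ v < n ] h u v))
                    (sum-cong-≗ (λ u → ∑-involution p-inv (h (p u))))
    ∑²-distrib-+ : ∑² (λ u v → h u v + h (p u) (p v)) ≡ ∑² h + ∑² (λ u v → h (p u) (p v))
    ∑²-distrib-+ = trans (sum-cong-≗ (λ u → ∑-distrib-+ (h u) (h (p u) ∘ p)))
                         (∑-distrib-+ (λ u → ∑[ v < n ] h u v) (λ u → ∑[ v < n ] h (p u) (p v)))

∑²-ordered≡C2 : ∀ n → ∑² (λ (u v : Fin n) → 𝟙 (u <? v)) ≡ n C 2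
∑²-ordered≡C2 ℕ.zero    = refl
∑²-ordered≡C2 (ℕ.suc n) = begin
  ∑[ v < n ] 1 + ∑² (λ (u v : Fin n) → 𝟙 (u <? v))  ≡⟨ cong₂ _+_ (∑-const n) (∑²-ordered≡C2 n) ⟩
  n + n C 2                                       ≡⟨ cong (_+ n C 2) (nC1≡n n) ⟨
  n C 1 + n C 2                                   ≡⟨ nCk+nC[k+1]≡[n+1]C[k+1] n 1 ⟩
  ℕ.suc n C 2                                     ∎
  where
  open ≡-Reasoning
  ∑-const : ∀ n → ∑[ v < n ] 1 ≡ n
  ∑-const ℕ.zero    = refl
  ∑-const (ℕ.suc n) = cong ℕ.suc (∑-const n)

module _ {k : ℕ} {F : Pred (Edge k) 0ℓ} (F? : Decidable F) (F-sym : ∀ {u v} → F (u , v) → F (v , u)) where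

  private
    ordered apart orderedF symF : Fin k → Fin k → ℕ
    ordered u v  = 𝟙 (u <? v)
    apart u v    = ordered u v + ordered v u
    orderedF u v = ordered u v * 𝟙 (F? (u , v))
    symF u v     = orderedF u v + orderedF v u

    symF-diagonal : ∀ u → symF u u ≡ 0
    symF-diagonal u rewrite 𝟙<-irrefl u = refl

    symF-offdiagonal : ∀ {u v} → u ≢ v → symF u v ≡ 𝟙 (F? (u , v))
    symF-offdiagonal {u} {v} u≢v = begin
      ordered u v * 𝟙 (F? (u , v)) + ordered v u * 𝟙 (F? (v , u))
        ≡⟨ cong (ordered u v * 𝟙 (F? (u , v)) +_)
                (cong (ordered v u *_) (𝟙-⇔ F-sym F-sym (F? (v , u)) (F? (u , v)))) ⟩
      ordered u v * 𝟙 (F? (u , v)) + ordered v u * 𝟙 (F? (u , v))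
        ≡⟨ *-distribʳ-+ (𝟙 (F? (u , v))) (ordered u v) (ordered v u) ⟨
      apart u v * 𝟙 (F? (u , v))
        ≡⟨ cong (_* 𝟙 (F? (u , v))) (𝟙<+𝟙>≡1 u≢v) ⟩
      1 * 𝟙 (F? (u , v))
        ≡⟨ *-identityˡ _ ⟩
      𝟙 (F? (u , v)) ∎
      where open ≡-Reasoning

  2*countEdges≤C2 : {p : Fin k → Fin k} → (∀ a → p (p a) ≡ a) →
                    (∀ {u v} → u ≢ v → F (u , v) → ¬ F (p u , p v)) → 2 * countEdges k F? ≤ k C 2
  2*countEdges≤C2 {p} p-inv separated = *-cancelˡ-≤ 2 (begin
    2 * (2 * countEdges k F?)  ≡⟨ cong (λ x → 2 * (2 * x)) (countEdges≡∑² k F?) ⟩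
    2 * (2 * ∑² orderedF)      ≡⟨ cong (2 *_) (∑²-symmetrize orderedF) ⟨
    2 * ∑² symF                ≤⟨ ∑²-involution-bound {p = p} p-inv symF apart bound ⟩
    ∑² apart                   ≡⟨ ∑²-symmetrize ordered ⟩
    2 * ∑² ordered             ≡⟨ cong (2 *_) (∑²-ordered≡C2 k) ⟩
    2 * (k C 2)                ∎)
    where
    open ≤-Reasoning
    bound : ∀ u v → symF u v + symF (p u) (p v) ≤ apart u v
    bound u v with u ≟ v
    ... | yes refl = ≤-trans (≤-reflexive (cong₂ _+_ (symF-diagonal u) (symF-diagonal (p u)))) z≤n
    ... | no u≢v   = begin
      symF u v + symF (p u) (p v)
        ≡⟨ cong₂ _+_ (symF-offdiagonal u≢v) (symF-offdiagonal (u≢v ∘ involution-injective p-inv)) ⟩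
      𝟙 (F? (u , v)) + 𝟙 (F? (p u , p v))  ≤⟨ 𝟙+𝟙≤1 (separated u≢v) (F? (u , v)) (F? (p u , p v)) ⟩
      1                                   ≡⟨ 𝟙<+𝟙>≡1 u≢v ⟨
      apart u v                           ∎

_≤ₗₑₓ_ _<ₗₑₓ_ : Rel (ℕ × ℕ) 0ℓ
_≤ₗₑₓ_ = ×-Lex _≡_ _<_ _≤_
_<ₗₑₓ_ = ×-Lex _≡_ _<_ _<_

-- Optimal R M unfolds to
--   ∀ M' → lexScore (m R M' round1) (m R M' round2) ≤ₗₑₓ lexScore (m R M round1) (m R M round2).
lexScore : ℕ → ℕ → ℕ × ℕ
lexScore n₁ n₂ = (n₁ + n₂ , n₁)

lexScore-translation : ∀ {a₁ a₂ b₁ b₂ d₁ d₂ e₁ e₂} → a₁ + d₁ ≡ b₁ + e₁ → a₂ + d₂ ≡ b₂ + e₂ →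
                       lexScore a₁ a₂ ≤ₗₑₓ lexScore b₁ b₂ → ¬ (lexScore d₁ d₂ <ₗₑₓ lexScore e₁ e₂)
lexScore-translation {a₁} {a₂} {b₁} {b₂} {d₁} {d₂} {e₁} {e₂} eq₁ eq₂ = contradict
  where
  total : (a₁ + a₂) + (d₁ + d₂) ≡ (b₁ + b₂) + (e₁ + e₂)
  total = trans (interchange a₁ a₂ d₁ d₂) (trans (cong₂ _+_ eq₁ eq₂) (sym (interchange b₁ b₂ e₁ e₂)))
  contradict : lexScore a₁ a₂ ≤ₗₑₓ lexScore b₁ b₂ → ¬ (lexScore d₁ d₂ <ₗₑₓ lexScore e₁ e₂)
  contradict (inj₁ a<b)        (inj₁ d<e)        = ℕₚ.<-irrefl total (+-mono-< a<b d<e)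
  contradict (inj₁ a<b)        (inj₂ (d≡e , _))  = ℕₚ.<-irrefl total (+-mono-<-≤ a<b (≤-reflexive d≡e))
  contradict (inj₂ (a≡b , _))  (inj₁ d<e)        = ℕₚ.<-irrefl total (+-mono-≤-< (≤-reflexive a≡b) d<e)
  contradict (inj₂ (_ , a₁≤b₁)) (inj₂ (_ , d₁<e₁)) = ℕₚ.<-irrefl eq₁ (+-mono-≤-< a₁≤b₁ d₁<e₁)

occurrences : Round → Round → Round → ℕ
occurrences c i j = 𝟙 (i ≟ c) + 𝟙 (j ≟ c)

pairScore : Round → Round → ℕ × ℕ
pairScore i j = lexScore (occurrences round1 i j) (occurrences round2 i j)

-- Both s and t lie below max i j.  If that maximum is round 3 the count of rounds 1, 2
-- goes up; if it is round 2 then s = t = round 1 and the count of round 1 goes up.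
-- The 81 cases are checked by evaluation.
swap-improves : ∀ i j s t → (s <ᶠ i ⊎ s <ᶠ j) → (t <ᶠ i ⊎ t <ᶠ j) → pairScore i j <ₗₑₓ pairScore s t
swap-improves = toWitness {a? = all? λ i → all? λ j → all? λ s → all? λ t →
  ((s <? i) ⊎-dec (s <? j)) →-dec ((t <? i) ⊎-dec (t <? j)) →-dec
  ×-decidable ℕₚ._≟_ ℕₚ._<?_ ℕₚ._<?_ (pairScore i j) (pairScore s t)} _

-- Perfect matchings and the exchange

module _ {k : ℕ} (M : PerfectMatching k) where

  private
    p = partner M

  2*∑-lowerEndpoints≡∑ : (f : Fin k → ℕ) → (∀ a → f (p a) ≡ f a) →
                         2 * ∑[ a < k ] (𝟙 (a <? p a) * f a) ≡ sum f
  2*∑-lowerEndpoints≡∑ f f-p = begin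
    2 * sum h                  ≡⟨ cong (sum h +_) (+-identityʳ (sum h)) ⟩
    sum h + sum h              ≡⟨ cong (sum h +_) (∑-involution (involutive M) h) ⟩
    sum h + sum (h ∘ p)        ≡⟨ ∑-distrib-+ h (h ∘ p) ⟨
    ∑[ a < k ] (h a + h (p a)) ≡⟨ sum-cong-≗ pair ⟩
    sum f                      ∎
    where
    open ≡-Reasoning
    h : Fin k → ℕ
    h a = 𝟙 (a <? p a) * f a
    pair : ∀ a → h a + h (p a) ≡ f a
    pair a = begin
      h a + h (p a)
        ≡⟨ cong (h a +_) (cong₂ (λ x y → 𝟙 (p a <? x) * y) (involutive M a) (f-p a)) ⟩
      𝟙 (a <? p a) * f a + 𝟙 (p a <? a) * f a ≡⟨ *-distribʳ-+ (f a) (𝟙 (a <? p a)) _ ⟨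
      (𝟙 (a <? p a) + 𝟙 (p a <? a)) * f a      ≡⟨ cong (_* f a) (𝟙<+𝟙>≡1 (noFixed M a ∘ sym)) ⟩
      1 * f a                                  ≡⟨ *-identityˡ (f a) ⟩
      f a                                      ∎

module _ {k : ℕ} (R : RoundAssignment k) (M : PerfectMatching k) where

  private
    p = partner M

  roundAt-partner : ∀ a → roundAt R M (p a) ≡ roundAt R M a
  roundAt-partner a = trans (cong (r R (p a)) (involutive M a)) (symm R (p a) a)

  covered : Round → Fin k → ℕ
  covered c a = 𝟙 (roundAt R M a ≟ c)

  2*m≡∑covered : ∀ c → 2 * m R M c ≡ sum (covered c)
  2*m≡∑covered c = begin
    2 * m R M c
      ≡⟨ cong (2 *_) (countEdges≡∑² k (inMi? R M c)) ⟩
    2 * ∑² (λ u v → 𝟙 (u <? v) * 𝟙 (inMi? R M c (u , v)))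
      ≡⟨ cong (2 *_) (sum-cong-≗ row) ⟩
    2 * ∑[ u < k ] (𝟙 (u <? p u) * covered c u)
      ≡⟨ 2*∑-lowerEndpoints≡∑ M (covered c) (λ a → cong (λ i → 𝟙 (i ≟ c)) (roundAt-partner a)) ⟩
    sum (covered c) ∎
    where
    open ≡-Reasoning
    row : ∀ u → ∑[ v < k ] (𝟙 (u <? v) * 𝟙 (inMi? R M c (u , v))) ≡ 𝟙 (u <? p u) * covered c u
    row u = begin
      ∑[ v < k ] (𝟙 (u <? v) * 𝟙 ((p u ≟ v) ×-dec (r R u v ≟ c)))
        ≡⟨ sum-cong-≗ (λ v → cong (𝟙 (u <? v) *_) (𝟙-×-dec (p u ≟ v) (r R u v ≟ c))) ⟩
      ∑[ v < k ] (𝟙 (u <? v) * (𝟙 (p u ≟ v) * 𝟙 (r R u v ≟ c)))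
        ≡⟨ sum-cong-≗ (λ v → x∙yz≈y∙xz (𝟙 (u <? v)) (𝟙 (p u ≟ v)) (𝟙 (r R u v ≟ c))) ⟩
      ∑[ v < k ] (𝟙 (p u ≟ v) * (𝟙 (u <? v) * 𝟙 (r R u v ≟ c)))
        ≡⟨ sum-cong-≗ (λ v → cong (_* (𝟙 (u <? v) * 𝟙 (r R u v ≟ c)))
                                 (𝟙-⇔ sym sym (p u ≟ v) (v ≟ p u))) ⟩
      ∑[ v < k ] (𝟙 (v ≟ p u) * (𝟙 (u <? v) * 𝟙 (r R u v ≟ c)))
        ≡⟨ ∑-δ (p u) (λ v → 𝟙 (u <? v) * 𝟙 (r R u v ≟ c)) ⟩
      𝟙 (u <? p u) * covered c u ∎

conjugate : ∀ {k} → Permutation k k → PerfectMatching k → PerfectMatching k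
conjugate π M = record
  { partner    = λ a → π ⟨$⟩ʳ partner M (π ⟨$⟩ˡ a)
  ; involutive = λ a → trans (cong (λ b → π ⟨$⟩ʳ partner M b) (inverseˡ π))
                       (trans (cong (π ⟨$⟩ʳ_) (involutive M (π ⟨$⟩ˡ a))) (inverseʳ π))
  ; noFixed    = λ a eq → noFixed M (π ⟨$⟩ˡ a) (trans (sym (inverseˡ π)) (cong (π ⟨$⟩ˡ_) eq))
  }

module _ {k : ℕ} (i j : Fin k) where

  transpose-matchˡ : PC.transpose i j i ≡ j
  transpose-matchˡ rewrite dec-true (i ≟ i) refl = refl

  transpose-matchʳ : PC.transpose i j j ≡ i
  transpose-matchʳ with j ≟ i
  ... | yes j≡i = j≡i
  ... | no  _   rewrite dec-true (j ≟ j) refl = refl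

  transpose-other : ∀ {a} → a ≢ i → a ≢ j → PC.transpose i j a ≡ a
  transpose-other {a} a≢i a≢j rewrite dec-false (a ≟ i) a≢i | dec-false (a ≟ j) a≢j = refl

module Swap {k : ℕ} (M : PerfectMatching k) {u v : Fin k} (u≢v : u ≢ v) (v≢pu : v ≢ partner M u) where

  private
    p = partner M

    u≢pu : u ≢ p u
    u≢pu = noFixed M u ∘ sym
    v≢pv : v ≢ p v
    v≢pv = noFixed M v ∘ sym
    u≢pv : u ≢ p v
    u≢pv u≡pv = v≢pu (trans (sym (involutive M v)) (cong p (sym u≡pv)))
    pu≢v : p u ≢ v
    pu≢v = v≢pu ∘ sym
    pu≢pv : p u ≢ p v
    pu≢pv = u≢v ∘ involution-injective (involutive M)

  -- Conjugating by the transposition of v and p u replaces the M-edges {u, p u}, {v, p v}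
  -- by {u, v}, {p u, p v}.
  swapped : PerfectMatching k
  swapped = conjugate (transpose v (p u)) M

  corners : List (Fin k)
  corners = u ∷ p u ∷ v ∷ p v ∷ []

  corners-unique : Unique corners
  corners-unique = (u≢pu ∷ u≢v ∷ u≢pv ∷ []) ∷ (pu≢v ∷ pu≢pv ∷ []) ∷ (v≢pv ∷ []) ∷ [] ∷ []

  swapped-u : partner swapped u ≡ v
  swapped-u = trans (cong (PC.transpose v (p u) ∘ p) (transpose-other (p u) v u≢pu u≢v))
                    (transpose-matchʳ v (p u))

  swapped-pu : partner swapped (p u) ≡ p v
  swapped-pu = trans (cong (PC.transpose v (p u) ∘ p) (transpose-matchˡ (p u) v))
                     (transpose-other v (p u) (v≢pv ∘ sym) (pu≢pv ∘ sym))

  swapped-outside : ∀ {a} → a ∉ corners → partner swapped a ≡ p a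
  swapped-outside {a} a∉ = trans (cong (PC.transpose v (p u) ∘ p) (transpose-other (p u) v a≢pu a≢v))
                                 (transpose-other v (p u) pa≢v pa≢pu)
    where
    a≢pu : a ≢ p u
    a≢pu = a∉ ∘ there ∘ here
    a≢v : a ≢ v
    a≢v = a∉ ∘ there ∘ there ∘ here
    pa≢v : p a ≢ v
    pa≢v pa≡v = a∉ (there (there (there (here (trans (sym (involutive M a)) (cong p pa≡v))))))
    pa≢pu : p a ≢ p u
    pa≢pu = a∉ ∘ here ∘ involution-injective (involutive M)

  sum-corners : (f : Fin k → ℕ) → sumᴸ (map f corners) ≡ (f u + f (p u)) + (f v + f (p v))
  sum-corners f = regroup (f u) (f (p u)) (f v) (f (p v))
    where
    regroup : ∀ a b c d → a + (b + (c + (d + 0))) ≡ (a + b) + (c + d)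
    regroup = solve-∀

  module _ (R : RoundAssignment k) (c : Round) where

    m-swapped : m R swapped c + occurrences c (roundAt R M u) (roundAt R M v)
              ≡ m R M c + occurrences c (r R u v) (r R (p u) (p v))
    m-swapped = *-cancelˡ-≡ _ _ 2 (begin
      2 * (m R swapped c + (old u + old v))
        ≡⟨ spread (m R swapped c) (old u) (old v) ⟩
      2 * m R swapped c + ((old u + old u) + (old v + old v))
        ≡⟨ cong₂ _+_ (2*m≡∑covered R swapped c) (sym old-corners) ⟩
      sum new + sumᴸ (map old corners)
        ≡⟨ ∑-agree-outside corners-unique agree ⟩
      sum old + sumᴸ (map new corners)
        ≡⟨ cong₂ _+_ (sym (2*m≡∑covered R M c)) new-corners ⟩
      2 * m R M c + ((new u + new (p u)) + (new u + new (p u)))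
        ≡⟨ spread′ (m R M c) (new u) (new (p u)) ⟩
      2 * (m R M c + (new u + new (p u)))
        ≡⟨ cong (λ x → 2 * (m R M c + x))
                (cong₂ (λ a b → 𝟙 (r R u a ≟ c) + 𝟙 (r R (p u) b ≟ c)) swapped-u swapped-pu) ⟩
      2 * (m R M c + occurrences c (r R u v) (r R (p u) (p v))) ∎)
      where
      open ≡-Reasoning
      old new : Fin k → ℕ
      old = covered R M c
      new = covered R swapped c
      spread : ∀ x y z → 2 * (x + (y + z)) ≡ 2 * x + ((y + y) + (z + z))
      spread = solve-∀
      spread′ : ∀ x y z → 2 * x + ((y + z) + (y + z)) ≡ 2 * (x + (y + z))
      spread′ = solve-∀
      old-partner : ∀ a → old (p a) ≡ old a
      old-partner a = cong (λ i → 𝟙 (i ≟ c)) (roundAt-partner R M a)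
      new-partner : ∀ a → new (partner swapped a) ≡ new a
      new-partner a = cong (λ i → 𝟙 (i ≟ c)) (roundAt-partner R swapped a)
      old-corners : sumᴸ (map old corners) ≡ (old u + old u) + (old v + old v)
      old-corners = trans (sum-corners old)
                          (cong₂ _+_ (cong (old u +_) (old-partner u)) (cong (old v +_) (old-partner v)))
      new-corners : sumᴸ (map new corners) ≡ (new u + new (p u)) + (new u + new (p u))
      new-corners = trans (sum-corners new)
        (cong ((new u + new (p u)) +_)
              (cong₂ _+_ (trans (cong new (sym swapped-u)) (new-partner u))
                         (trans (cong new (sym swapped-pu)) (new-partner (p u)))))
      agree : ∀ a → a ∉ corners → new a ≡ old a
      agree a a∉ = cong (λ b → 𝟙 (r R a b ≟ c)) (swapped-outside a∉)

module _ {k : ℕ} (R : RoundAssignment k) (M : PerfectMatching k) where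

  private
    p = partner M

  Free-sym : ∀ {u v} → Free R M (u , v) → Free R M (v , u)
  Free-sym {u} {v} = Sum.map (subst (_<ᶠ roundAt R M v) (symm R u v))
                             (subst (_<ᶠ roundAt R M u) (symm R u v)) ∘ Sum.swap

  matchingEdge-not-free : ∀ u → ¬ Free R M (u , p u)
  matchingEdge-not-free u = [ <-irrefl refl , <-irrefl (sym (roundAt-partner R M u)) ]′

  Free-partners : ∀ {u v} → Free R M (p u , p v) →
                  (r R (p u) (p v) <ᶠ roundAt R M u) ⊎ (r R (p u) (p v) <ᶠ roundAt R M v)
  Free-partners {u} {v} = Sum.map (subst (r R (p u) (p v) <ᶠ_) (roundAt-partner R M u))
                                  (subst (r R (p u) (p v) <ᶠ_) (roundAt-partner R M v))

  optimal⇒not-both-free : Optimal R M → ∀ {u v} → u ≢ v → Free R M (u , v) → ¬ Free R M (p u , p v)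
  optimal⇒not-both-free optimal {u} {v} u≢v free free′ with v ≟ p u
  ... | yes refl  = matchingEdge-not-free u free
  ... | no v≢pu = lexScore-translation (m-swapped R round1) (m-swapped R round2) (optimal swapped)
                    (swap-improves _ _ _ _ free (Free-partners free′))
    where open Swap M u≢v v≢pu

lemma9 : (k : ℕ) → 2 ∣ k → (R : RoundAssignment k) → (M : PerfectMatching k)
         → Optimal R M → 2 * numFree R M ≤ k C 2
lemma9 k _ R M optimal =
  2*countEdges≤C2 (free? R M) (Free-sym R M) (involutive M) (optimal⇒not-both-free R M optimal)
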